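{- Let $\mapsto_\alpha,\mapsto_\gamma$ be root relations on $\Lambda$. (i) If $\to_{\neg\mathsf l\alpha}\cdot\mapsto_\gamma\subseteq\to_{\mathsf l\gamma}\cdot\to_\alpha^*$, then $\to_{\neg\mathsf l\alpha}\cdot\to_{\mathsf l\gamma}\subseteq\to_{\mathsf l\gamma}\cdot\to_\alpha^*$. (ii) If $\to_{\neg\mathsf w\alpha}\cdot\mapsto_\gamma\subseteq\to_{\mathsf w\gamma}\cdot\to_\alpha^*$, then $\to_{\neg\mathsf w\alpha}\cdot\to_{\mathsf w\gamma}\subseteq\to_{\mathsf w\gamma}\cdot\to_\alpha^*$. (iii) For $\mathsf e\in\{\mathsf l,\mathsf w\}$: if $\to_{\neg\mathsf e\alpha}\cdot\mapsto_\gamma\subseteq\to_{\mathsf e\gamma}\cdot\to_\alpha^=$, then $\to_{\neg\mathsf e\alpha}\cdot\to_{\mathsf e\gamma}\subseteq\to_{\mathsf e\gamma}\cdot\to_\alpha^=$.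
   Context: Terms $\Lambda$: $t::=x\mid c\mid\lambda x.t\mid tt$ ($c$ constants from a possibly empty set). Values $v::=x\mid c\mid\lambda x.t$. Contexts $C::=\langle\cdot\rangle\mid tC\mid Ct\mid\lambda x.C$; contextual closure $\to_\rho$ of a root relation $\mapsto_\rho$: $C\langle r\rangle\to_\rho C\langle r'\rangle$ for $r\mapsto_\rho r'$. Left contexts $L::=\langle\cdot\rangle\mid Lt\mid vL$; weak contexts $W::=\langle\cdot\rangle\mid Wt\mid tW$. $\to_{\mathsf l\rho}$ / $\to_{\mathsf w\rho}$: closure under left / weak contexts; $\to_{\neg\mathsf l\rho}$ / $\to_{\neg\mathsf w\rho}$: closure under contexts that are not left / not weak. $\to^*,\to^=$ reflexive-transitive and reflexive closure; $R\cdot S$ composition. -}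

module Defs where

open import Level using (Level; _⊔_; suc)
open import Data.Product using (Σ; _×_; _,_; ∃-syntax)
open import Relation.Nullary using (¬_)
open import Data.Unit using (⊤)
open import Relation.Binary.Construct.Closure.ReflexiveTransitive using (Star)
open import Relation.Binary.Construct.Closure.Reflexive using (ReflClosure)

module Lambda {a b : Level} (V : Set a) (Const : Set b) where

  data Term : Set (a ⊔ b) where
    var : V → Term
    con : Const → Term
    lam : V → Term → Term
    app : Term → Term → Term

  data Value : Term → Set (a ⊔ b) where
    var : ∀ x → Value (var x)
    con : ∀ c → Value (con c)
    lam : ∀ x t → Value (lam x t)

  data Ctx : Set (a ⊔ b) where
    hole : Ctx
    appR : Term → Ctx → Ctx
    appL : Ctx → Term → Ctx
    lamC : V → Ctx → Ctx

  plug : Ctx → Term → Term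
  plug hole r = r
  plug (appR t C) r = app t (plug C r)
  plug (appL C t) r = app (plug C r) t
  plug (lamC x C) r = lam x (plug C r)

  data IsLeft : Ctx → Set (a ⊔ b) where
    hole : IsLeft hole
    appL : ∀ {C} t → IsLeft C → IsLeft (appL C t)
    appR : ∀ {v C} → Value v → IsLeft C → IsLeft (appR v C)

  data IsWeak : Ctx → Set (a ⊔ b) where
    hole : IsWeak hole
    appL : ∀ {C} t → IsWeak C → IsWeak (appL C t)
    appR : ∀ {C} t → IsWeak C → IsWeak (appR t C)

  Rel : (ℓ : Level) → Set (a ⊔ b ⊔ Level.suc ℓ)
  Rel ℓ = Term → Term → Set ℓ

  data CtxClos {ℓ p : Level} (P : Ctx → Set p) (ρ : Rel ℓ) : Rel (a ⊔ b ⊔ ℓ ⊔ p) where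
    step : ∀ {C r r'} → P C → ρ r r' → CtxClos P ρ (plug C r) (plug C r')

  AnyCtx : Ctx → Set
  AnyCtx _ = ⊤

  full : ∀ {ℓ} → Rel ℓ → Rel (a ⊔ b ⊔ ℓ)
  full = CtxClos AnyCtx

  leftR : ∀ {ℓ} → Rel ℓ → Rel (a ⊔ b ⊔ ℓ)
  leftR = CtxClos IsLeft

  weakR : ∀ {ℓ} → Rel ℓ → Rel (a ⊔ b ⊔ ℓ)
  weakR = CtxClos IsWeak

  nonLeftR : ∀ {ℓ} → Rel ℓ → Rel (a ⊔ b ⊔ ℓ)
  nonLeftR = CtxClos (λ C → ¬ IsLeft C)

  nonWeakR : ∀ {ℓ} → Rel ℓ → Rel (a ⊔ b ⊔ ℓ)
  nonWeakR = CtxClos (λ C → ¬ IsWeak C)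

  _⨾_ : ∀ {ℓ₁ ℓ₂} → Rel ℓ₁ → Rel ℓ₂ → Rel (a ⊔ b ⊔ ℓ₁ ⊔ ℓ₂)
  (R ⨾ S) t u = ∃[ s ] (R t s × S s u)

  _⊆_ : ∀ {ℓ₁ ℓ₂} → Rel ℓ₁ → Rel ℓ₂ → Set (a ⊔ b ⊔ ℓ₁ ⊔ ℓ₂)
  R ⊆ S = ∀ {t u} → R t u → S t u

  star : ∀ {ℓ} → Rel ℓ → Rel (a ⊔ b ⊔ ℓ)
  star R = Star R

  refl= : ∀ {ℓ} → Rel ℓ → Rel (a ⊔ b ⊔ ℓ)
  refl= R = ReflClosure R

  data Strategy : Set where
    l w : Strategy

  eR : ∀ {ℓ} → Strategy → Rel ℓ → Rel (a ⊔ b ⊔ ℓ)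
  eR l = leftR
  eR w = weakR

  non-eR : ∀ {ℓ} → Strategy → Rel ℓ → Rel (a ⊔ b ⊔ ℓ)
  non-eR l = nonLeftR
  non-eR w = nonWeakR

module Submission where

-- Left and weak contexts are both instances of *guarded* contexts: contexts
-- built from ⟨⋅⟩ by  C t  and  u C , where the function part u of every
-- right application must satisfy a predicate A on terms (A = Value for left
-- contexts, A = everything for weak ones).  We prove the lemma once for an
-- arbitrary guard A which cannot tell apart terms differing strictly inside
-- a non-empty context, and for an arbitrary target relation S (→α* or →α=)
-- that contains →α and is closed under both application contexts.
--
-- The core lemma proceeds by induction on the evaluation context L of the
-- γ-redex, matched against the non-evaluation context C of the α-step: at
-- L = ⟨⋅⟩ the hypothesis applies; if C and L descend into the same side of
-- an application we use induction; if they descend into different sides,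
-- the two steps are disjoint and commute directly with one α-step.

open import Defs
open import Level using (Level; _⊔_)
open import Function using (_∘_)
open import Data.Product using (_×_; _,_)
open import Data.Unit using (⊤; tt)
open import Data.Empty using (⊥-elim)
open import Relation.Nullary using (¬_)
open import Relation.Binary.PropositionalEquality using (_≡_; _≢_; refl; subst; sym)
import Relation.Binary.Construct.Closure.ReflexiveTransitive as Star
import Relation.Binary.Construct.Closure.Reflexive as Refl

module _ {a b : Level} {V : Set a} {Const : Set b} where
  open Lambda V Const

  app-injective : ∀ {s t s' t' : Term} → app s t ≡ app s' t' → (s ≡ s') × (t ≡ t')
  app-injective refl = refl , refl

  reindex : ∀ {p q ℓ} {P : Ctx → Set p} {Q : Ctx → Set q} {ρ : Rel ℓ} →
            (∀ {C} → P C → Q C) → CtxClos P ρ ⊆ CtxClos Q ρ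
  reindex P⇒Q (step pC r) = step (P⇒Q pC) r

  data Guarded {p} (A : Term → Set p) : Ctx → Set (a ⊔ b ⊔ p) where
    hole : Guarded A hole
    appL : ∀ {C} t → Guarded A C → Guarded A (appL C t)
    appR : ∀ {u C} → A u → Guarded A C → Guarded A (appR u C)

  left⇒guarded : ∀ {C} → IsLeft C → Guarded Value C
  left⇒guarded hole         = hole
  left⇒guarded (appL t L)   = appL t (left⇒guarded L)
  left⇒guarded (appR v L)   = appR v (left⇒guarded L)

  guarded⇒left : ∀ {C} → Guarded Value C → IsLeft C
  guarded⇒left hole         = hole
  guarded⇒left (appL t G)   = appL t (guarded⇒left G)
  guarded⇒left (appR v G)   = appR v (guarded⇒left G)

  Unguarded : Ctx → Set (a ⊔ b)
  Unguarded = Guarded (λ _ → ⊤)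

  weak⇒guarded : ∀ {C} → IsWeak C → Unguarded C
  weak⇒guarded hole         = hole
  weak⇒guarded (appL t W)   = appL t (weak⇒guarded W)
  weak⇒guarded (appR t W)   = appR tt (weak⇒guarded W)

  guarded⇒weak : ∀ {C} → Unguarded C → IsWeak C
  guarded⇒weak hole         = hole
  guarded⇒weak (appL t G)   = appL t (guarded⇒weak G)
  guarded⇒weak (appR {u} _ G) = appR u (guarded⇒weak G)

  -- Being a value only depends on the outermost constructor, so it cannot
  -- change when a non-empty context is filled differently.
  value-stable : ∀ C {s s'} → C ≢ hole → Value (plug C s) → Value (plug C s')
  value-stable hole       C≢hole _ = ⊥-elim (C≢hole refl)
  value-stable (lamC x C) _      _ = lam x _

  record Target {ℓα ℓs} (α : Rel ℓα) (S : Rel ℓs) : Set (a ⊔ b ⊔ ℓα ⊔ ℓs) where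
    field
      under-appL : ∀ {s s' t} → S s s' → S (app s t) (app s' t)
      under-appR : ∀ {s s' t} → S s s' → S (app t s) (app t s')
      one-step   : full α ⊆ S

  full-appL : ∀ {ℓ} {α : Rel ℓ} {s s' t} → full α s s' → full α (app s t) (app s' t)
  full-appL {t = t} (step _ r) = step {C = appL _ t} tt r

  full-appR : ∀ {ℓ} {α : Rel ℓ} {s s' t} → full α s s' → full α (app t s) (app t s')
  full-appR {t = t} (step _ r) = step {C = appR t _} tt r

  star-target : ∀ {ℓ} (α : Rel ℓ) → Target α (star (full α))
  star-target α = record
    { under-appL = Star.gmap _ full-appL
    ; under-appR = Star.gmap _ full-appR
    ; one-step   = Star.return
    }

  refl-target : ∀ {ℓ} (α : Rel ℓ) → Target α (refl= (full α))
  refl-target α = record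
    { under-appL = Refl.map full-appL
    ; under-appR = Refl.map full-appR
    ; one-step   = Refl.[_]
    }

  module Commutation
    {p ℓα ℓγ ℓs} (A : Term → Set p)
    (A-stable : ∀ C {s s'} → C ≢ hole → A (plug C s) → A (plug C s'))
    (α : Rel ℓα) (γ : Rel ℓγ) {S : Rel ℓs} (target : Target α S) where

    open Target target

    evalR : ∀ {ℓ} → Rel ℓ → Rel (a ⊔ b ⊔ p ⊔ ℓ)
    evalR = CtxClos (Guarded A)

    nonEvalR : ∀ {ℓ} → Rel ℓ → Rel (a ⊔ b ⊔ p ⊔ ℓ)
    nonEvalR = CtxClos (λ C → ¬ Guarded A C)

    eval-appL : ∀ {s s' t} → evalR γ s s' → evalR γ (app s t) (app s' t)
    eval-appL {t = t} (step G g) = step (appL t G) g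

    eval-appR : ∀ {s s' u} → A u → evalR γ s s' → evalR γ (app u s) (app u s')
    eval-appR Au (step G g) = step (appR Au G) g

    head-non-hole : ∀ {C t} → ¬ Guarded A (appL C t) → C ≢ hole
    head-non-hole {t = t} ¬G refl = ¬G (appL t hole)

    Hypothesis : Set (a ⊔ b ⊔ p ⊔ ℓα ⊔ ℓγ ⊔ ℓs)
    Hypothesis = (nonEvalR α ⨾ γ) ⊆ (evalR γ ⨾ S)

    commute-redex : Hypothesis →
      ∀ C {r r'} → ¬ Guarded A C → α r r' →
      ∀ {L q q'} → Guarded A L → γ q q' → plug C r' ≡ plug L q →
      (evalR γ ⨾ S) (plug C r) (plug L q')
    commute-redex h C ¬G a hole g eq =
      h (_ , step ¬G a , subst (λ m → γ m _) (sym eq) g)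
    commute-redex h hole ¬G a (appL _ _) g eq = ⊥-elim (¬G hole)
    commute-redex h hole ¬G a (appR _ _) g eq = ⊥-elim (¬G hole)
    commute-redex h (lamC _ _) ¬G a (appL _ _) g ()
    commute-redex h (lamC _ _) ¬G a (appR _ _) g ()
    commute-redex h (appL C t) ¬G a (appL _ L) g eq with app-injective eq
    ... | eq₁ , refl with commute-redex h C (¬G ∘ appL t) a L g eq₁
    ... | _ , ev , s = _ , eval-appL ev , under-appL s
    commute-redex h (appR _ C) ¬G a (appR Au L) g eq with app-injective eq
    ... | refl , eq₂ with commute-redex h C (¬G ∘ appR Au) a L g eq₂
    ... | _ , ev , s = _ , eval-appR Au ev , under-appR s
    -- α in the argument, γ in the function: disjoint steps
    commute-redex h (appR _ C) ¬G a (appL _ L) g eq with app-injective eq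
    ... | refl , refl = _ , eval-appL (step L g) , one-step (step {C = appR _ C} tt a)
    -- α in the function, γ in the argument: the function stays guarded
    commute-redex h (appL C t) ¬G a (appR Au L) g eq with app-injective eq
    ... | refl , refl =
      _ , eval-appR (A-stable C (head-non-hole ¬G) Au) (step L g)
        , one-step (step {C = appL C _} tt a)

    commute : Hypothesis → (nonEvalR α ⨾ evalR γ) ⊆ (evalR γ ⨾ S)
    commute h (_ , nonEval , step {L} {q} {q'} G g) = from-step nonEval refl
      where
      from-step : ∀ {t m} → nonEvalR α t m → m ≡ plug L q → (evalR γ ⨾ S) t (plug L q')
      from-step (step ¬G a) eq = commute-redex h _ ¬G a G g eq

    commute-for : ∀ {q} {P : Ctx → Set q} →
      (∀ {C} → P C → Guarded A C) → (∀ {C} → Guarded A C → P C) →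
      (CtxClos (λ C → ¬ P C) α ⨾ γ) ⊆ (CtxClos P γ ⨾ S) →
      (CtxClos (λ C → ¬ P C) α ⨾ CtxClos P γ) ⊆ (CtxClos P γ ⨾ S)
    commute-for {P = P} P⇒G G⇒P h (_ , nonP , evP) =
      eval⇒P (commute hypothesis (_ , reindex (λ ¬P → ¬P ∘ G⇒P) nonP , reindex P⇒G evP))
      where
      eval⇒P : ∀ {t u} → (evalR γ ⨾ S) t u → (CtxClos P γ ⨾ S) t u
      eval⇒P (_ , ev , s) = _ , reindex G⇒P ev , s

      hypothesis : Hypothesis
      hypothesis (_ , nonEval , g) with h (_ , reindex (λ ¬G → ¬G ∘ P⇒G) nonEval , g)
      ... | _ , evP' , s = _ , reindex P⇒G evP' , s

  left-commute : ∀ {ℓα ℓγ ℓs} (α : Rel ℓα) (γ : Rel ℓγ) {S : Rel ℓs} → Target α S →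
    (nonLeftR α ⨾ γ) ⊆ (leftR γ ⨾ S) → (nonLeftR α ⨾ leftR γ) ⊆ (leftR γ ⨾ S)
  left-commute α γ target =
    Commutation.commute-for Value value-stable α γ target left⇒guarded guarded⇒left

  weak-commute : ∀ {ℓα ℓγ ℓs} (α : Rel ℓα) (γ : Rel ℓγ) {S : Rel ℓs} → Target α S →
    (nonWeakR α ⨾ γ) ⊆ (weakR γ ⨾ S) → (nonWeakR α ⨾ weakR γ) ⊆ (weakR γ ⨾ S)
  weak-commute α γ target =
    Commutation.commute-for (λ _ → ⊤) (λ _ _ _ → tt) α γ target weak⇒guarded guarded⇒weak

  strategy-commute : ∀ {ℓα ℓγ ℓs} (e : Strategy) (α : Rel ℓα) (γ : Rel ℓγ) {S : Rel ℓs} →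
    Target α S → (non-eR e α ⨾ γ) ⊆ (eR e γ ⨾ S) → (non-eR e α ⨾ eR e γ) ⊆ (eR e γ ⨾ S)
  strategy-commute l = left-commute
  strategy-commute w = weak-commute

lemmaA3 : ∀ {a b ℓα ℓγ : Level} (V : Set a) (Const : Set b) → let open Lambda V Const in (α : Rel ℓα) (γ : Rel ℓγ) → ((nonLeftR α ⨾ γ) ⊆ (leftR γ ⨾ star (full α)) → (nonLeftR α ⨾ leftR γ) ⊆ (leftR γ ⨾ star (full α))) × ((nonWeakR α ⨾ γ) ⊆ (weakR γ ⨾ star (full α)) → (nonWeakR α ⨾ weakR γ) ⊆ (weakR γ ⨾ star (full α))) × ((e : Strategy) → (non-eR e α ⨾ γ) ⊆ (eR e γ ⨾ refl= (full α)) → (non-eR e α ⨾ eR e γ) ⊆ (eR e γ ⨾ refl= (full α)))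
lemmaA3 V Const α γ =
    left-commute α γ (star-target α)
  , weak-commute α γ (star-target α)
  , λ e → strategy-commute e α γ (refl-target α)
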